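{- Let $b$ be an odd positive integer. Then for $|q|<1$, $$\sum_{n=0}^{\infty}N(3,5,4b;8n+9)q^n=4q^{\frac{b-1}2}\varphi(q^6)\psi(q^5)\psi(q^{4b})+4q\varphi(q^{2b})\psi(q^5)\psi(q^{12}).$$
   Context: For positive integers $a,b,c$ and $n\in\mathbb{N}=\{0,1,2,\dots\}$, $N(a,b,c;n)$ denotes the number of triples $(x,y,z)\in\mathbb{Z}^3$ with $n=ax^2+by^2+cz^2$. Ramanujan's theta functions are $\varphi(q)=\sum_{n=-\infty}^{\infty}q^{n^2}$ and $\psi(q)=\sum_{n=0}^{\infty}q^{n(n+1)/2}$ for $|q|<1$. -}

module Defs where

open import Data.Nat as ℕ using (ℕ; zero; suc; _+_; _*_; _∸_; _/_; _≤?_)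
open import Data.Integer as ℤ using (ℤ; +_; -[1+_])
open import Data.List using (List; []; _∷_; _++_; map; upTo; length; filter; concatMap)
open import Data.Nat.ListAction using (sum)
open import Data.Product using (_×_; _,_; ∃)
open import Relation.Nullary using (does)
open import Relation.Binary.PropositionalEquality using (_≡_)
open import Data.Bool using (if_then_else_)

Odd : ℕ → Set
Odd b = ∃ λ k → b ≡ 1 + 2 * k

zRange : ℕ → List ℤ
zRange m = map +_ (upTo (suc m)) ++ map -[1+_] (upTo m)

-- N(a,b,c;n) = #{(x,y,z) ∈ ℤ³ : n = a x² + b y² + c z²}.
-- For a,b,c ≥ 1 every solution has |x|,|y|,|z| ≤ n, so we enumerate [-n,n]³.
triples : ℕ → List (ℤ × ℤ × ℤ)
triples m = concatMap (λ x → concatMap (λ y → map (λ z → x , y , z) (zRange m)) (zRange m)) (zRange m)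

N : ℕ → ℕ → ℕ → ℕ → ℕ
N a b c n = length (filter (λ { (x , y , z) →
  (+ a ℤ.* (x ℤ.* x) ℤ.+ + b ℤ.* (y ℤ.* y) ℤ.+ + c ℤ.* (z ℤ.* z)) ℤ.≟ + n }) (triples n))

-- Formal power series in q with natural-number coefficients: n ↦ coefficient of qⁿ.
Series : Set
Series = ℕ → ℕ

-- φ(q) = Σ_{k ∈ ℤ} q^{k²}: coefficient of qⁿ is #{k ∈ ℤ : k² = n}
φ : Series
φ n = length (filter (λ k → (k ℤ.* k) ℤ.≟ + n) (zRange n))

-- ψ(q) = Σ_{k ≥ 0} q^{k(k+1)/2}: coefficient of qⁿ is #{k ∈ ℕ : k(k+1)/2 = n}
ψ : Series
ψ n = length (filter (λ k → (k * (k + 1)) ℕ.≟ (2 * n)) (upTo (suc n)))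

-- f(q) ↦ f(q^m)  (for m ≥ 1): coefficient of qⁿ is Σ_{k : m k = n} f_k
dil : ℕ → Series → Series
dil m f n = sum (map (λ k → if does ((m * k) ℕ.≟ n) then f k else 0) (upTo (suc n)))

-- f(q) ↦ q^s f(q)
shift : ℕ → Series → Series
shift s f n = if does (s ≤? n) then f (n ∸ s) else 0

_⊛_ : Series → Series → Series
(f ⊛ g) n = sum (map (λ i → f i * g (n ∸ i)) (upTo (suc n)))
infixl 7 _⊛_

_·_ : ℕ → Series → Series
(c · f) n = c * f n
infixl 7 _·_

_⊕_ : Series → Series → Series
(f ⊕ g) n = f n + g n
infixl 6 _⊕_

module Submission where

-- Both sides of the identity are finite weighted counts of lattice points,
-- and the proof matches the two counts.
--
-- * Grouping the signs of (x, y, z) ∈ ℤ³, N(3,5,4b;m) is the sum over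
--   (a, b', c) ∈ ℕ³ of w(a) w(b') w(c) [3a² + 5b'² + 4bc² = m], where w(0) = 1
--   and w(s) = 2 for s > 0 (the number of integers of absolute value s).
-- * The coefficients of φ(q^d) count d s² with weight w(s), those of ψ(q^d)
--   count d T(t) with T(t) = t(t+1)/2, so the coefficients of a product of
--   three such series are weighted triple sums of indicators.
-- * For m = 8n + 9 and b = 2k + 1, reducing modulo 4 and 8 shows that a is
--   even, b' is odd, and either a = 4s and c is odd, or a = 2(2s+1) and c is
--   even.  With (2v+1)² = 1 + 8T(v) the equation becomes
--   6s² + 5T(v) + 4bT(t) + k = n,  respectively  2bt² + 5T(v) + 12T(s) + 1 = n,
--   which are the two terms of the right-hand side, each carrying weight 4.

open import Defs
open import Data.Nat using (ℕ; zero; suc; _+_; _*_; _∸_; _/_; _≤_; _<_; z≤n; s≤s; z<s; s<s; _≟_; _≤?_; _≡ᵇ_; _≤ᵇ_; NonZero)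
open import Data.Nat.Properties
open import Data.Nat.DivMod using (_%_; [m+kn]%n≡m%n; m*n/n≡m)
open import Data.Nat.Tactic.RingSolver using (solve-∀)
open import Data.Nat.ListAction using (sum)
open import Data.Nat.ListAction.Properties using (sum-++)
open import Data.Bool using (Bool; true; false; if_then_else_)
open import Data.List using (List; []; _∷_; _++_; map; upTo; applyUpTo; length; filter; concatMap)
open import Data.List.Properties using (map-++; map-∘; map-cong)
open import Data.Integer as ℤ using (ℤ; -[1+_]; ∣_∣)
open import Data.Integer.Properties using (pos-*)
open import Data.Product using (∃; _×_; _,_)
open import Data.Sum using (_⊎_; inj₁; inj₂)
open import Data.Empty using (⊥-elim)
open import Data.Unit using (tt)
open import Function using (_∘_)
open import Relation.Binary.PropositionalEquality
open import Relation.Nullary using (¬_; yes; no; does)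
open import Relation.Unary using (Pred; Decidable)
open import Level using (Level)
open import Algebra.Properties.CommutativeSemigroup +-commutativeSemigroup
  using () renaming (interchange to +-interchange)
open import Algebra.Properties.CommutativeSemigroup *-commutativeSemigroup
  using () renaming (x∙yz≈y∙xz to *-left-comm)

open ≡-Reasoning

private variable
  ℓ p : Level
  A B : Set ℓ

ind : Bool → ℕ
ind true  = 1
ind false = 0

-- δ m n = [m = n]; it unfolds to the same boolean test `does (m ≟ n)` used in Defs.
δ : ℕ → ℕ → ℕ
δ m n = ind (does (m ≟ n))

δ-yes : ∀ {m n} → m ≡ n → δ m n ≡ 1
δ-yes {m} {n} m≡n with m ≡ᵇ n | ≡⇒≡ᵇ m n m≡n
... | true | _ = refl

δ-no : ∀ {m n} → m ≢ n → δ m n ≡ 0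
δ-no {m} {n} m≢n with m ≡ᵇ n | ≡ᵇ⇒≡ m n
... | true  | toEq = ⊥-elim (m≢n (toEq tt))
... | false | _    = refl

δ-cong : ∀ {m n m′ n′} → (m ≡ n → m′ ≡ n′) → (m′ ≡ n′ → m ≡ n) → δ m n ≡ δ m′ n′
δ-cong {m} {n} to from with m ≟ n
... | yes m≡n = trans (δ-yes m≡n) (sym (δ-yes (to m≡n)))
... | no m≢n  = trans (δ-no m≢n) (sym (δ-no (m≢n ∘ from)))

∑ : ℕ → (ℕ → ℕ) → ℕ
∑ zero    f = 0
∑ (suc n) f = f 0 + ∑ n (λ k → f (suc k))

∑-cong< : ∀ n {f g} → (∀ k → k < n → f k ≡ g k) → ∑ n f ≡ ∑ n g
∑-cong< zero    e = refl
∑-cong< (suc n) e = cong₂ _+_ (e 0 z<s) (∑-cong< n (λ k k<n → e (suc k) (s<s k<n)))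

∑-cong : ∀ n {f g} → (∀ k → f k ≡ g k) → ∑ n f ≡ ∑ n g
∑-cong n e = ∑-cong< n (λ k _ → e k)

∑-zero : ∀ n {f} → (∀ k → f k ≡ 0) → ∑ n f ≡ 0
∑-zero zero    e = refl
∑-zero (suc n) e = cong₂ _+_ (e 0) (∑-zero n (λ k → e (suc k)))

∑-weighted-zero : ∀ n (x : ℕ → ℕ) {f : ℕ → ℕ} → (∀ k → f k ≡ 0) → ∑ n (λ k → x k * f k) ≡ 0
∑-weighted-zero n x e = ∑-zero n (λ k → trans (cong (x k *_) (e k)) (*-zeroʳ (x k)))

∑-+ : ∀ n {f g} → ∑ n (λ k → f k + g k) ≡ ∑ n f + ∑ n g
∑-+ zero            = refl
∑-+ (suc n) {f} {g} = trans (cong (f 0 + g 0 +_) (∑-+ n)) (+-interchange (f 0) (g 0) _ _)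

∑-*ˡ : ∀ n c {f} → ∑ n (λ k → c * f k) ≡ c * ∑ n f
∑-*ˡ zero    c     = sym (*-zeroʳ c)
∑-*ˡ (suc n) c {f} = trans (cong (c * f 0 +_) (∑-*ˡ n c)) (sym (*-distribˡ-+ c (f 0) _))

∑-*ʳ : ∀ n c {f} → ∑ n (λ k → f k * c) ≡ ∑ n f * c
∑-*ʳ n c {f} = trans (∑-cong n (λ k → *-comm (f k) c)) (trans (∑-*ˡ n c) (*-comm c _))

∑-swap : ∀ m n {f : ℕ → ℕ → ℕ} → ∑ m (λ i → ∑ n (f i)) ≡ ∑ n (λ j → ∑ m (λ i → f i j))
∑-swap zero    n     = sym (∑-zero n (λ _ → refl))
∑-swap (suc m) n {f} = trans (cong (∑ n (f 0) +_) (∑-swap m n)) (sym (∑-+ n))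

∑-++ : ∀ a b {f} → ∑ (a + b) f ≡ ∑ a f + ∑ b (λ k → f (a + k))
∑-++ zero    b     = refl
∑-++ (suc a) b {f} = trans (cong (f 0 +_) (∑-++ a b)) (sym (+-assoc (f 0) _ _))

∑-truncate : ∀ B L {f} → B ≤ L → (∀ k → B ≤ k → f k ≡ 0) → ∑ L f ≡ ∑ B f
∑-truncate B L {f} B≤L tail = begin
  ∑ L f                                   ≡⟨ cong (λ n → ∑ n f) (sym (m+[n∸m]≡n B≤L)) ⟩
  ∑ (B + (L ∸ B)) f                       ≡⟨ ∑-++ B (L ∸ B) ⟩
  ∑ B f + ∑ (L ∸ B) (λ k → f (B + k))     ≡⟨ cong (∑ B f +_) (∑-zero (L ∸ B) (λ k → tail (B + k) (m≤m+n B k))) ⟩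
  ∑ B f + 0                               ≡⟨ +-identityʳ _ ⟩
  ∑ B f                                   ∎

∑-parity : ∀ K f → ∑ (K + K) f ≡ ∑ K (λ u → f (2 * u)) + ∑ K (λ u → f (1 + 2 * u))
∑-parity zero    f = refl
∑-parity (suc K) f = begin
  ∑ (suc K + suc K) f
    ≡⟨ cong (λ n → ∑ (suc n) f) (+-suc K K) ⟩
  f 0 + (f 1 + ∑ (K + K) (λ k → f (2 + k)))
    ≡⟨ cong (λ s → f 0 + (f 1 + s)) (∑-parity K (λ k → f (2 + k))) ⟩
  f 0 + (f 1 + (∑ K (λ u → f (2 + 2 * u)) + ∑ K (λ u → f (3 + 2 * u))))
    ≡⟨ shuffle (f 0) (f 1) _ _ ⟩
  (f 0 + ∑ K (λ u → f (2 + 2 * u))) + (f 1 + ∑ K (λ u → f (3 + 2 * u)))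
    ≡⟨ cong₂ (λ g h → (f 0 + g) + (f 1 + h))
         (∑-cong K (λ u → cong f (sym (*-suc 2 u)))) (∑-cong K (λ u → cong (f ∘ suc) (sym (*-suc 2 u)))) ⟩
  (f 0 + ∑ K (λ u → f (2 * suc u))) + (f 1 + ∑ K (λ u → f (1 + 2 * suc u)))  ∎
  where
  shuffle : ∀ a b c d → a + (b + (c + d)) ≡ (a + c) + (b + d)
  shuffle = solve-∀

∑-evens : ∀ K f → (∀ u → f (1 + 2 * u) ≡ 0) → ∑ (K + K) f ≡ ∑ K (λ u → f (2 * u))
∑-evens K f odd≡0 =
  trans (∑-parity K f) (trans (cong (∑ K (λ u → f (2 * u)) +_) (∑-zero K odd≡0)) (+-identityʳ _))

∑-odds : ∀ K f → (∀ u → f (2 * u) ≡ 0) → ∑ (K + K) f ≡ ∑ K (λ u → f (1 + 2 * u))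
∑-odds K f even≡0 = trans (∑-parity K f) (cong (_+ ∑ K (λ u → f (1 + 2 * u))) (∑-zero K even≡0))

∑-pick : ∀ n c (g : ℕ → ℕ) → (n ≤ c → g c ≡ 0) → ∑ n (λ k → δ c k * g k) ≡ g c
∑-pick zero    c       g outside = sym (outside z≤n)
∑-pick (suc n) zero    g _       = begin
  g 0 + 0 + ∑ n (λ _ → 0)   ≡⟨ cong (g 0 + 0 +_) (∑-zero n (λ _ → refl)) ⟩
  g 0 + 0 + 0               ≡⟨ trans (+-identityʳ _) (+-identityʳ _) ⟩
  g 0                       ∎
∑-pick (suc n) (suc c) g outside = ∑-pick n c (g ∘ suc) (outside ∘ s≤s)

∑-pull : ∀ n K (c : ℕ → ℕ) (X : ℕ → ℕ → ℕ) (h : ℕ → ℕ) →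
  ∑ n (λ i → ∑ K (λ a → c a * X a i) * h i) ≡ ∑ K (λ a → c a * ∑ n (λ i → X a i * h i))
∑-pull n K c X h = begin
  ∑ n (λ i → ∑ K (λ a → c a * X a i) * h i)    ≡⟨ ∑-cong n (λ i → sym (∑-*ʳ K (h i))) ⟩
  ∑ n (λ i → ∑ K (λ a → c a * X a i * h i))    ≡⟨ ∑-swap n K ⟩
  ∑ K (λ a → ∑ n (λ i → c a * X a i * h i))    ≡⟨ ∑-cong K (λ a → ∑-cong n (λ i → *-assoc (c a) (X a i) (h i))) ⟩
  ∑ K (λ a → ∑ n (λ i → c a * (X a i * h i)))  ≡⟨ ∑-cong K (λ a → ∑-*ˡ n (c a)) ⟩
  ∑ K (λ a → c a * ∑ n (λ i → X a i * h i))    ∎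

-- Weighted triple sums, the common shape of both sides of the theorem:
--   W³ L₁ L₂ L₃ x y z g = ∑_{a<L₁} x a ∑_{b<L₂} y b ∑_{c<L₃} z c · g a b c
W³ : ℕ → ℕ → ℕ → (ℕ → ℕ) → (ℕ → ℕ) → (ℕ → ℕ) → (ℕ → ℕ → ℕ → ℕ) → ℕ
W³ L₁ L₂ L₃ x y z g = ∑ L₁ (λ a → x a * ∑ L₂ (λ b → y b * ∑ L₃ (λ c → z c * g a b c)))

W³-cong : ∀ L₁ L₂ L₃ x y z {g g′} → (∀ a b c → g a b c ≡ g′ a b c) →
  W³ L₁ L₂ L₃ x y z g ≡ W³ L₁ L₂ L₃ x y z g′
W³-cong L₁ L₂ L₃ x y z e =
  ∑-cong L₁ (λ a → cong (x a *_) (∑-cong L₂ (λ b → cong (y b *_) (∑-cong L₃ (λ c → cong (z c *_) (e a b c))))))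

W³-zero : ∀ L₁ L₂ L₃ x y z {g} → (∀ a b c → g a b c ≡ 0) → W³ L₁ L₂ L₃ x y z g ≡ 0
W³-zero L₁ L₂ L₃ x y z e =
  ∑-weighted-zero L₁ x (λ a → ∑-weighted-zero L₂ y (λ b → ∑-weighted-zero L₃ z (e a b)))

W³-truncate : ∀ B L x y z g → B ≤ L → (∀ a b c → B ≤ a ⊎ B ≤ b ⊎ B ≤ c → g a b c ≡ 0) →
  W³ L L L x y z g ≡ W³ B B B x y z g
W³-truncate B L x y z g B≤L outside = begin
  ∑ L (λ a → x a * ∑ L (λ b → y b * ∑ L (λ c → z c * g a b c)))
    ≡⟨ ∑-cong L (λ a → cong (x a *_) (∑-cong L (λ b → cong (y b *_)
         (∑-truncate B L B≤L (λ c B≤c →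
            trans (cong (z c *_) (outside a b c (inj₂ (inj₂ B≤c)))) (*-zeroʳ (z c))))))) ⟩
  ∑ L (λ a → x a * ∑ L (λ b → y b * ∑ B (λ c → z c * g a b c)))
    ≡⟨ ∑-cong L (λ a → cong (x a *_) (∑-truncate B L B≤L (λ b B≤b →
         trans (cong (y b *_) (∑-weighted-zero B z (λ c → outside a b c (inj₂ (inj₁ B≤b)))))
               (*-zeroʳ (y b))))) ⟩
  ∑ L (λ a → x a * ∑ B (λ b → y b * ∑ B (λ c → z c * g a b c)))
    ≡⟨ ∑-truncate B L B≤L (λ a B≤a →
         trans (cong (x a *_) (∑-weighted-zero B y (λ b → ∑-weighted-zero B z (λ c → outside a b c (inj₁ B≤a)))))
               (*-zeroʳ (x a))) ⟩
  W³ B B B x y z g  ∎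

W³-scale : ∀ L₁ L₂ L₃ x y z c d g →
  W³ L₁ L₂ L₃ x (λ b → c * y b) (λ t → d * z t) g ≡ c * d * W³ L₁ L₂ L₃ x y z g
W³-scale L₁ L₂ L₃ x y z c d g = begin
  ∑ L₁ (λ a → x a * ∑ L₂ (λ b → c * y b * ∑ L₃ (λ t → d * z t * g a b t)))
    ≡⟨ ∑-cong L₁ (λ a → cong (x a *_) (∑-cong L₂ (λ b → cong (c * y b *_)
         (trans (∑-cong L₃ (λ t → *-assoc d (z t) _)) (∑-*ˡ L₃ d))))) ⟩
  ∑ L₁ (λ a → x a * ∑ L₂ (λ b → c * y b * (d * inner a b)))
    ≡⟨ ∑-cong L₁ (λ a → cong (x a *_) (trans (∑-cong L₂ (λ b → regroup c d (y b) (inner a b))) (∑-*ˡ L₂ (c * d)))) ⟩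
  ∑ L₁ (λ a → x a * (c * d * middle a))
    ≡⟨ ∑-cong L₁ (λ a → *-left-comm (x a) (c * d) (middle a)) ⟩
  ∑ L₁ (λ a → c * d * (x a * middle a))
    ≡⟨ ∑-*ˡ L₁ (c * d) ⟩
  c * d * W³ L₁ L₂ L₃ x y z g  ∎
  where
  inner : ℕ → ℕ → ℕ
  inner a b = ∑ L₃ (λ t → z t * g a b t)
  middle : ℕ → ℕ
  middle a = ∑ L₂ (λ b → y b * inner a b)
  regroup : ∀ c d y s → c * y * (d * s) ≡ c * d * (y * s)
  regroup = solve-∀

W³-flat : ∀ L₁ L₂ L₃ x y z g →
  W³ L₁ L₂ L₃ x y z g ≡ ∑ L₁ (λ a → ∑ L₂ (λ b → ∑ L₃ (λ c → x a * (y b * (z c * g a b c)))))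
W³-flat L₁ L₂ L₃ x y z g = ∑-cong L₁ (λ a → begin
  x a * ∑ L₂ (λ b → y b * ∑ L₃ (λ c → z c * g a b c))    ≡⟨ cong (x a *_) (∑-cong L₂ (λ b → sym (∑-*ˡ L₃ (y b)))) ⟩
  x a * ∑ L₂ (λ b → ∑ L₃ (λ c → y b * (z c * g a b c)))  ≡⟨ sym (∑-*ˡ L₂ (x a)) ⟩
  ∑ L₂ (λ b → x a * ∑ L₃ (λ c → y b * (z c * g a b c)))  ≡⟨ ∑-cong L₂ (λ b → sym (∑-*ˡ L₃ (x a))) ⟩
  ∑ L₂ (λ b → ∑ L₃ (λ c → x a * (y b * (z c * g a b c))))  ∎)

W³-reverse : ∀ L₁ L₂ L₃ x y z g → W³ L₁ L₂ L₃ x y z g ≡ W³ L₃ L₂ L₁ z y x (λ c b a → g a b c)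
W³-reverse L₁ L₂ L₃ x y z g = begin
  W³ L₁ L₂ L₃ x y z g
    ≡⟨ W³-flat L₁ L₂ L₃ x y z g ⟩
  ∑ L₁ (λ a → ∑ L₂ (λ b → ∑ L₃ (λ c → x a * (y b * (z c * g a b c)))))
    ≡⟨ ∑-cong L₁ (λ a → ∑-swap L₂ L₃) ⟩
  ∑ L₁ (λ a → ∑ L₃ (λ c → ∑ L₂ (λ b → x a * (y b * (z c * g a b c)))))
    ≡⟨ ∑-swap L₁ L₃ ⟩
  ∑ L₃ (λ c → ∑ L₁ (λ a → ∑ L₂ (λ b → x a * (y b * (z c * g a b c)))))
    ≡⟨ ∑-cong L₃ (λ c → ∑-swap L₁ L₂) ⟩
  ∑ L₃ (λ c → ∑ L₂ (λ b → ∑ L₁ (λ a → x a * (y b * (z c * g a b c)))))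
    ≡⟨ ∑-cong L₃ (λ c → ∑-cong L₂ (λ b → ∑-cong L₁ (λ a → reverse (x a) (y b) (z c) (g a b c)))) ⟩
  ∑ L₃ (λ c → ∑ L₂ (λ b → ∑ L₁ (λ a → z c * (y b * (x a * g a b c)))))
    ≡⟨ sym (W³-flat L₃ L₂ L₁ z y x (λ c b a → g a b c)) ⟩
  W³ L₃ L₂ L₁ z y x (λ c b a → g a b c)  ∎
  where
  reverse : ∀ x y z s → x * (y * (z * s)) ≡ z * (y * (x * s))
  reverse = solve-∀

length-filter : {P : Pred A p} (P? : Decidable P) (xs : List A) →
  length (filter P? xs) ≡ sum (map (λ x → ind (does (P? x))) xs)
length-filter P? [] = refl
length-filter P? (x ∷ xs) with does (P? x)
... | true  = cong suc (length-filter P? xs)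
... | false = length-filter P? xs

sum-applyUpTo : ∀ n (h : ℕ → A) (g : A → ℕ) → sum (map g (applyUpTo h n)) ≡ ∑ n (g ∘ h)
sum-applyUpTo zero    h g = refl
sum-applyUpTo (suc n) h g = cong (g (h 0) +_) (sum-applyUpTo n (h ∘ suc) g)

sum-upTo : ∀ n (g : ℕ → ℕ) → sum (map g (upTo n)) ≡ ∑ n g
sum-upTo n g = sum-applyUpTo n (λ k → k) g

sum-concatMap : (xs : List A) (g : A → List B) (f : B → ℕ) →
  sum (map f (concatMap g xs)) ≡ sum (map (λ x → sum (map f (g x))) xs)
sum-concatMap []       g f = refl
sum-concatMap (x ∷ xs) g f = begin
  sum (map f (g x ++ concatMap g xs))                ≡⟨ cong sum (map-++ f (g x) _) ⟩
  sum (map f (g x) ++ map f (concatMap g xs))        ≡⟨ sum-++ (map f (g x)) _ ⟩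
  sum (map f (g x)) + sum (map f (concatMap g xs))   ≡⟨ cong (sum (map f (g x)) +_) (sum-concatMap xs g f) ⟩
  sum (map (λ x → sum (map f (g x))) (x ∷ xs))        ∎

-- w s is the number of integers of absolute value s.
w : ℕ → ℕ
w zero    = 1
w (suc _) = 2

w-double : ∀ t → w (2 * t) ≡ w t
w-double zero    = refl
w-double (suc t) = refl

-- Summing a function of |x| over x ∈ [-m, m] groups x with -x.
sum-zRange : ∀ m (g : ℤ → ℕ) (h : ℕ → ℕ) → (∀ x → g x ≡ h ∣ x ∣) →
  sum (map g (zRange m)) ≡ ∑ (suc m) (λ s → w s * h s)
sum-zRange m g h g≡h∣∣ = begin
  sum (map g (map ℤ.+_ (upTo (suc m)) ++ map -[1+_] (upTo m)))
    ≡⟨ cong sum (map-++ g (map ℤ.+_ (upTo (suc m))) _) ⟩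
  sum (map g (map ℤ.+_ (upTo (suc m))) ++ map g (map -[1+_] (upTo m)))
    ≡⟨ sum-++ (map g (map ℤ.+_ (upTo (suc m)))) _ ⟩
  sum (map g (map ℤ.+_ (upTo (suc m)))) + sum (map g (map -[1+_] (upTo m)))
    ≡⟨ cong₂ _+_ (cong sum (sym (map-∘ (upTo (suc m))))) (cong sum (sym (map-∘ (upTo m)))) ⟩
  sum (map (g ∘ ℤ.+_) (upTo (suc m))) + sum (map (g ∘ -[1+_]) (upTo m))
    ≡⟨ cong₂ _+_ (sum-upTo (suc m) _) (sum-upTo m _) ⟩
  ∑ (suc m) (g ∘ ℤ.+_) + ∑ m (g ∘ -[1+_])
    ≡⟨ cong₂ _+_ (∑-cong (suc m) (g≡h∣∣ ∘ ℤ.+_)) (∑-cong m (g≡h∣∣ ∘ -[1+_])) ⟩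
  h 0 + S + S
    ≡⟨ regroup (h 0) S ⟩
  1 * h 0 + 2 * S
    ≡⟨ cong (1 * h 0 +_) (sym (∑-*ˡ m 2)) ⟩
  ∑ (suc m) (λ s → w s * h s)  ∎
  where
  S : ℕ
  S = ∑ m (h ∘ suc)
  regroup : ∀ a s → a + s + s ≡ 1 * a + 2 * s
  regroup = solve-∀

square-∣∣ : ∀ x → x ℤ.* x ≡ ℤ.+ (∣ x ∣ * ∣ x ∣)
square-∣∣ (ℤ.+ zero)    = refl
square-∣∣ (ℤ.+ (suc k)) = refl
square-∣∣ -[1+ k ]      = refl

Q-δ : ℕ → ℕ → ℕ → ℕ → ℕ → ℕ → ℕ → ℕ
Q-δ A B C m a b c = δ (A * (a * a) + B * (b * b) + C * (c * c)) m

N-as-W³ : ∀ A B C m → N A B C m ≡ W³ (suc m) (suc m) (suc m) w w w (Q-δ A B C m)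
N-as-W³ A B C m = begin
  N A B C m
    ≡⟨ length-filter _ (triples m) ⟩
  sum (map test (triples m))
    ≡⟨ sum-concatMap zR (λ x → concatMap (λ y → map (λ z → x , y , z) zR) zR) test ⟩
  sum (map (λ x → sum (map test (concatMap (λ y → map (λ z → x , y , z) zR) zR))) zR)
    ≡⟨ cong sum (map-cong (λ x → trans (sum-concatMap zR (λ y → map (λ z → x , y , z) zR) test)
                                      (cong sum (map-cong (λ y → cong sum (sym (map-∘ zR))) zR))) zR) ⟩
  sum (map (λ x → sum (map (λ y → sum (map (λ z → test (x , y , z)) zR)) zR)) zR)
    ≡⟨ sum-zRange m _ (λ a → ∑ (suc m) (λ b → w b * ∑ (suc m) (λ c → w c * Q-δ A B C m a b c))) (λ x → trans
         (cong sum (map-cong (λ y → sum-zRange m _ (Q-δ A B C m (∣ x ∣) (∣ y ∣)) (test-∣∣ x y)) zR))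
         (sum-zRange m _ (λ b → ∑ (suc m) (λ c → w c * Q-δ A B C m (∣ x ∣) b c)) (λ _ → refl))) ⟩
  W³ (suc m) (suc m) (suc m) w w w (Q-δ A B C m)  ∎
  where
  zR : List ℤ
  zR = zRange m
  test : ℤ × ℤ × ℤ → ℕ
  test (x , y , z) =
    ind (does ((ℤ.+ A ℤ.* (x ℤ.* x) ℤ.+ ℤ.+ B ℤ.* (y ℤ.* y) ℤ.+ ℤ.+ C ℤ.* (z ℤ.* z)) ℤ.≟ ℤ.+ m))
  test-∣∣ : ∀ x y z → test (x , y , z) ≡ Q-δ A B C m (∣ x ∣) (∣ y ∣) (∣ z ∣)
  test-∣∣ x y z rewrite square-∣∣ x | square-∣∣ y | square-∣∣ z
    | sym (pos-* A (∣ x ∣ * ∣ x ∣)) | sym (pos-* B (∣ y ∣ * ∣ y ∣)) | sym (pos-* C (∣ z ∣ * ∣ z ∣)) = refl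

-- F counts the values p a with weights α a: each coefficient F i is the
-- weighted number of a with p a = i, and any initial segment of indices
-- longer than i already contains all of them.
record Counts (F : Series) (α p : ℕ → ℕ) : Set where
  field
    coefficient : ∀ i L → i < L → F i ≡ ∑ L (λ a → α a * δ (p a) i)

open Counts

-- If p a ≥ a, no index a > i satisfies p a = i, so longer sums add nothing.
∑-δ-inflationary : ∀ (α p : ℕ → ℕ) → (∀ a → a ≤ p a) → ∀ i L → i < L →
  ∑ L (λ a → α a * δ (p a) i) ≡ ∑ (suc i) (λ a → α a * δ (p a) i)
∑-δ-inflationary α p a≤p i L i<L = ∑-truncate (suc i) L i<L (λ a i<a →
  trans (cong (α a *_) (δ-no (λ p≡i → <⇒≱ i<a (subst (a ≤_) p≡i (a≤p a))))) (*-zeroʳ (α a)))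

T : ℕ → ℕ
T zero    = 0
T (suc t) = suc t + T t

T-double : ∀ t → t * (t + 1) ≡ 2 * T t
T-double zero    = refl
T-double (suc t) = begin
  suc t * (suc t + 1)      ≡⟨ expand t ⟩
  2 * suc t + t * (t + 1)  ≡⟨ cong (2 * suc t +_) (T-double t) ⟩
  2 * suc t + 2 * T t      ≡⟨ sym (*-distribˡ-+ 2 (suc t) (T t)) ⟩
  2 * T (suc t)            ∎
  where
  expand : ∀ t → suc t * (suc t + 1) ≡ 2 * suc t + t * (t + 1)
  expand = solve-∀

T-inflationary : ∀ t → t ≤ T t
T-inflationary zero    = z≤n
T-inflationary (suc t) = m≤m+n (suc t) (T t)

square-inflationary : ∀ s → s ≤ s * s
square-inflationary zero    = z≤n
square-inflationary (suc s) = m≤m*n (suc s) (suc s)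

counts-ψ : Counts ψ (λ _ → 1) T
coefficient counts-ψ i L i<L = begin
  ψ i
    ≡⟨ length-filter (λ t → (t * (t + 1)) ≟ (2 * i)) (upTo (suc i)) ⟩
  sum (map (λ t → δ (t * (t + 1)) (2 * i)) (upTo (suc i)))
    ≡⟨ sum-upTo (suc i) _ ⟩
  ∑ (suc i) (λ t → δ (t * (t + 1)) (2 * i))
    ≡⟨ ∑-cong (suc i) (λ t → trans (δ-cong (halve t) (trans (T-double t) ∘ cong (2 *_))) (sym (*-identityˡ _))) ⟩
  ∑ (suc i) (λ t → 1 * δ (T t) i)
    ≡⟨ sym (∑-δ-inflationary (λ _ → 1) T T-inflationary i L i<L) ⟩
  ∑ L (λ t → 1 * δ (T t) i)  ∎
  where
  halve : ∀ t → t * (t + 1) ≡ 2 * i → T t ≡ i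
  halve t e = *-cancelˡ-≡ (T t) i 2 (trans (sym (T-double t)) e)

counts-φ : Counts φ w (λ s → s * s)
coefficient counts-φ i L i<L = begin
  φ i
    ≡⟨ length-filter (λ x → (x ℤ.* x) ℤ.≟ ℤ.+ i) (zRange i) ⟩
  sum (map (λ x → ind (does ((x ℤ.* x) ℤ.≟ ℤ.+ i))) (zRange i))
    ≡⟨ sum-zRange i _ (λ s → δ (s * s) i) (λ x → cong (λ y → ind (does (y ℤ.≟ ℤ.+ i))) (square-∣∣ x)) ⟩
  ∑ (suc i) (λ s → w s * δ (s * s) i)
    ≡⟨ sym (∑-δ-inflationary w (λ s → s * s) square-inflationary i L i<L) ⟩
  ∑ L (λ s → w s * δ (s * s) i)  ∎

dil-∑ : ∀ m f i → dil m f i ≡ ∑ (suc i) (λ k → f k * δ (m * k) i)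
dil-∑ m f i = trans (sum-upTo (suc i) _) (∑-cong (suc i) (λ k → if-as-product (does ((m * k) ≟ i)) (f k)))
  where
  if-as-product : ∀ b x → (if b then x else 0) ≡ x * ind b
  if-as-product true  x = sym (*-identityʳ x)
  if-as-product false x = sym (*-zeroʳ x)

counts-dil : ∀ {f α p} → Counts f α p → ∀ m .{{_ : NonZero m}} → Counts (dil m f) α (λ a → m * p a)
coefficient (counts-dil {f} {α} {p} counts m) i L i<L = begin
  dil m f i
    ≡⟨ dil-∑ m f i ⟩
  ∑ (suc i) (λ k → f k * δ (m * k) i)
    ≡⟨ ∑-cong< (suc i) (λ k k≤i → cong (_* δ (m * k) i) (coefficient counts k L (<-≤-trans k≤i i<L))) ⟩
  ∑ (suc i) (λ k → ∑ L (λ a → α a * δ (p a) k) * δ (m * k) i)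
    ≡⟨ ∑-pull (suc i) L α (λ a k → δ (p a) k) (λ k → δ (m * k) i) ⟩
  ∑ L (λ a → α a * ∑ (suc i) (λ k → δ (p a) k * δ (m * k) i))
    ≡⟨ ∑-cong L (λ a → cong (α a *_) (∑-pick (suc i) (p a) (λ k → δ (m * k) i) (too-large a))) ⟩
  ∑ L (λ a → α a * δ (m * p a) i)  ∎
  where
  too-large : ∀ a → suc i ≤ p a → δ (m * p a) i ≡ 0
  too-large a i<p = δ-no (λ mp≡i → <⇒≱ i<p (subst (p a ≤_) mp≡i (m≤n*m (p a) m)))

⊛-∑ : ∀ F G m → (F ⊛ G) m ≡ ∑ (suc m) (λ i → F i * G (m ∸ i))
⊛-∑ F G m = sum-upTo (suc m) _

δ-⊛ : ∀ {H γ r} → Counts H γ r → ∀ m L → m < L → ∀ e →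
  ∑ (suc m) (λ i → δ e i * H (m ∸ i)) ≡ ∑ L (λ t → γ t * δ (e + r t) m)
δ-⊛ {H} {γ} {r} counts m L m<L e = begin
  ∑ (suc m) (λ i → δ e i * H (m ∸ i))
    ≡⟨ ∑-cong< (suc m) (λ i i≤m → cong (δ e i *_) (H-complement i (≤-pred i≤m))) ⟩
  ∑ (suc m) (λ i → δ e i * ∑ L (λ t → γ t * δ (i + r t) m))
    ≡⟨ ∑-pick (suc m) e (λ c → ∑ L (λ t → γ t * δ (c + r t) m)) (λ m<e → ∑-weighted-zero L γ (λ t →
         δ-no (λ e+r≡m → <⇒≱ m<e (subst (e ≤_) e+r≡m (m≤m+n e (r t)))))) ⟩
  ∑ L (λ t → γ t * δ (e + r t) m)  ∎
  where
  H-complement : ∀ i → i ≤ m → H (m ∸ i) ≡ ∑ L (λ t → γ t * δ (i + r t) m)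
  H-complement i i≤m = trans (coefficient counts (m ∸ i) L (≤-<-trans (m∸n≤m m i) m<L))
    (∑-cong L (λ t → cong (γ t *_) (δ-cong
      (λ r≡m-i → trans (cong (i +_) r≡m-i) (m+[n∸m]≡n i≤m))
      (λ i+r≡m → trans (sym (m+n∸m≡n i (r t))) (cong (_∸ i) i+r≡m)))))

counts-⊛ : ∀ {F G α β p q} → Counts F α p → Counts G β q → ∀ m L₁ L₂ → m < L₁ → m < L₂ →
  (F ⊛ G) m ≡ ∑ L₁ (λ a → α a * ∑ L₂ (λ b → β b * δ (p a + q b) m))
counts-⊛ {F} {G} {α} {β} {p} {q} countsF countsG m L₁ L₂ m<L₁ m<L₂ = begin
  (F ⊛ G) m
    ≡⟨ ⊛-∑ F G m ⟩
  ∑ (suc m) (λ i → F i * G (m ∸ i))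
    ≡⟨ ∑-cong< (suc m) (λ i i≤m → cong (_* G (m ∸ i)) (coefficient countsF i L₁ (<-≤-trans i≤m m<L₁))) ⟩
  ∑ (suc m) (λ i → ∑ L₁ (λ a → α a * δ (p a) i) * G (m ∸ i))
    ≡⟨ ∑-pull (suc m) L₁ α (λ a i → δ (p a) i) (λ i → G (m ∸ i)) ⟩
  ∑ L₁ (λ a → α a * ∑ (suc m) (λ i → δ (p a) i * G (m ∸ i)))
    ≡⟨ ∑-cong L₁ (λ a → cong (α a *_) (δ-⊛ countsG m L₂ m<L₂ (p a))) ⟩
  ∑ L₁ (λ a → α a * ∑ L₂ (λ b → β b * δ (p a + q b) m))  ∎

counts-⊛⊛ : ∀ {F G H α β γ p q r} → Counts F α p → Counts G β q → Counts H γ r →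
  ∀ m L₁ L₂ L₃ → m < L₁ → m < L₂ → m < L₃ →
  (F ⊛ G ⊛ H) m ≡ W³ L₁ L₂ L₃ α β γ (λ a b c → δ (p a + q b + r c) m)
counts-⊛⊛ {F} {G} {H} {α} {β} {γ} {p} {q} {r} countsF countsG countsH m L₁ L₂ L₃ m<L₁ m<L₂ m<L₃ = begin
  (F ⊛ G ⊛ H) m
    ≡⟨ ⊛-∑ (F ⊛ G) H m ⟩
  ∑ (suc m) (λ i → (F ⊛ G) i * H (m ∸ i))
    ≡⟨ ∑-cong< (suc m) (λ i i≤m → cong (_* H (m ∸ i))
         (counts-⊛ countsF countsG i L₁ L₂ (<-≤-trans i≤m m<L₁) (<-≤-trans i≤m m<L₂))) ⟩
  ∑ (suc m) (λ i → ∑ L₁ (λ a → α a * ∑ L₂ (λ b → β b * δ (p a + q b) i)) * H (m ∸ i))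
    ≡⟨ ∑-pull (suc m) L₁ α (λ a i → ∑ L₂ (λ b → β b * δ (p a + q b) i)) (λ i → H (m ∸ i)) ⟩
  ∑ L₁ (λ a → α a * ∑ (suc m) (λ i → ∑ L₂ (λ b → β b * δ (p a + q b) i) * H (m ∸ i)))
    ≡⟨ ∑-cong L₁ (λ a → cong (α a *_) (∑-pull (suc m) L₂ β (λ b i → δ (p a + q b) i) (λ i → H (m ∸ i)))) ⟩
  ∑ L₁ (λ a → α a * ∑ L₂ (λ b → β b * ∑ (suc m) (λ i → δ (p a + q b) i * H (m ∸ i))))
    ≡⟨ ∑-cong L₁ (λ a → cong (α a *_) (∑-cong L₂ (λ b → cong (β b *_)
         (δ-⊛ countsH m L₃ m<L₃ (p a + q b))))) ⟩
  W³ L₁ L₂ L₃ α β γ (λ a b c → δ (p a + q b + r c) m)  ∎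

shift-≤ : ∀ {j n} (F : Series) → j ≤ n → shift j F n ≡ F (n ∸ j)
shift-≤ {j} {n} F j≤n with j ≤ᵇ n | ≤⇒≤ᵇ j≤n
... | true | _ = refl

shift-≰ : ∀ {j n} (F : Series) → ¬ j ≤ n → shift j F n ≡ 0
shift-≰ {j} {n} F j≰n with j ≤ᵇ n | ≤ᵇ⇒≤ j n
... | true  | toLe = ⊥-elim (j≰n (toLe tt))
... | false | _    = refl

shift-W³ : ∀ j n F L₁ L₂ L₃ x y z (X : ℕ → ℕ → ℕ → ℕ) →
  (∀ m → m ≤ n → F m ≡ W³ L₁ L₂ L₃ x y z (λ a b c → δ (X a b c) m)) →
  shift j F n ≡ W³ L₁ L₂ L₃ x y z (λ a b c → δ (X a b c + j) n)
shift-W³ j n F L₁ L₂ L₃ x y z X coeffs with j ≤? n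
... | yes j≤n = begin
  shift j F n
    ≡⟨ shift-≤ F j≤n ⟩
  F (n ∸ j)
    ≡⟨ coeffs (n ∸ j) (m∸n≤m n j) ⟩
  W³ L₁ L₂ L₃ x y z (λ a b c → δ (X a b c) (n ∸ j))
    ≡⟨ W³-cong L₁ L₂ L₃ x y z (λ a b c → δ-cong
         (λ X≡n-j → trans (cong (_+ j) X≡n-j) (m∸n+n≡m j≤n))
         (λ X+j≡n → trans (sym (m+n∸n≡m (X a b c) j)) (cong (_∸ j) X+j≡n))) ⟩
  W³ L₁ L₂ L₃ x y z (λ a b c → δ (X a b c + j) n)  ∎
... | no j≰n = trans (shift-≰ F j≰n) (sym (W³-zero L₁ L₂ L₃ x y z (λ a b c →
  δ-no (λ X+j≡n → j≰n (subst (j ≤_) X+j≡n (m≤n+m j (X a b c)))))))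

parity : ∀ m → (∃ λ v → m ≡ 2 * v) ⊎ (∃ λ v → m ≡ 1 + 2 * v)
parity zero    = inj₁ (0 , refl)
parity (suc m) with parity m
... | inj₁ (v , m≡2v)   = inj₂ (v , cong suc m≡2v)
... | inj₂ (v , m≡1+2v) = inj₁ (suc v , trans (cong suc m≡1+2v) (sym (*-suc 2 v)))

odd-square : ∀ v → (1 + 2 * v) * (1 + 2 * v) ≡ 1 + 8 * T v
odd-square v = begin
  (1 + 2 * v) * (1 + 2 * v)  ≡⟨ expand v ⟩
  1 + 4 * (v * (v + 1))      ≡⟨ cong (λ x → 1 + 4 * x) (T-double v) ⟩
  1 + 4 * (2 * T v)          ≡⟨ cong suc (sym (*-assoc 4 2 (T v))) ⟩
  1 + 8 * T v                ∎
  where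
  expand : ∀ v → (1 + 2 * v) * (1 + 2 * v) ≡ 1 + 4 * (v * (v + 1))
  expand = solve-∀

δ-residues : ∀ q r t X Y .{{_ : NonZero q}} → r % q ≢ t % q → δ (r + X * q) (t + Y * q) ≡ 0
δ-residues q r t X Y r≢t = δ-no (λ eq →
  r≢t (trans (sym ([m+kn]%n≡m%n r X q)) (trans (cong (_% q) eq) ([m+kn]%n≡m%n t Y q))))

δ-affine : ∀ c d X n .{{_ : NonZero c}} → δ (c * X + d) (c * n + d) ≡ δ X n
δ-affine c d X n = δ-cong
  (λ eq → *-cancelˡ-≡ X n c (+-cancelʳ-≡ d (c * X) (c * n) eq))
  (cong (λ y → c * y + d))

module Solutions (k n : ℕ) where

  β : ℕ
  β = 1 + 2 * k

  form : ℕ → ℕ → ℕ → ℕ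
  form a b c = 3 * (a * a) + 5 * (b * b) + 4 * β * (c * c)

  E : ℕ → ℕ → ℕ → ℕ
  E = Q-δ 3 5 (4 * β) (8 * n + 9)

  form-squares : ∀ a b c {A B C} → a * a ≡ A → b * b ≡ B → c * c ≡ C → form a b c ≡ 3 * A + 5 * B + 4 * β * C
  form-squares a b c refl refl refl = refl

  -- 8n + 9 ≡ 1 modulo 4 and modulo 8, so E vanishes on other residues.
  E-mod4 : ∀ a b c r X → r % 4 ≢ 1 → form a b c ≡ r + X * 4 → E a b c ≡ 0
  E-mod4 a b c r X r≢1 form≡ = trans (cong₂ δ form≡ (target n)) (δ-residues 4 r 1 X (2 * n + 2) r≢1)
    where
    target : ∀ n → 8 * n + 9 ≡ 1 + (2 * n + 2) * 4
    target = solve-∀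

  E-mod8 : ∀ a b c r X → r % 8 ≢ 1 → form a b c ≡ r + X * 8 → E a b c ≡ 0
  E-mod8 a b c r X r≢1 form≡ = trans (cong₂ δ form≡ (target n)) (δ-residues 8 r 1 X (n + 1) r≢1)
    where
    target : ∀ n → 8 * n + 9 ≡ 1 + (n + 1) * 8
    target = solve-∀

  E-odd-a : ∀ u b c → E (1 + 2 * u) b c ≡ 0
  E-odd-a u b c with parity b
  ... | inj₁ (v , refl) =
    E-mod4 (1 + 2 * u) (2 * v) c 3 (3 * (u * u) + 3 * u + 5 * (v * v) + β * (c * c)) (λ ()) (identity u v k c)
    where
    identity : ∀ u v k c → 3 * ((1 + 2 * u) * (1 + 2 * u)) + 5 * (2 * v * (2 * v)) + 4 * (1 + 2 * k) * (c * c)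
                         ≡ 3 + (3 * (u * u) + 3 * u + 5 * (v * v) + (1 + 2 * k) * (c * c)) * 4
    identity = solve-∀
  ... | inj₂ (v , refl) =
    E-mod4 (1 + 2 * u) (1 + 2 * v) c 0 (3 * (u * u) + 3 * u + 5 * (v * v) + 5 * v + 2 + β * (c * c)) (λ ())
      (identity u v k c)
    where
    identity : ∀ u v k c → 3 * ((1 + 2 * u) * (1 + 2 * u)) + 5 * ((1 + 2 * v) * (1 + 2 * v)) + 4 * (1 + 2 * k) * (c * c)
                         ≡ 0 + (3 * (u * u) + 3 * u + 5 * (v * v) + 5 * v + 2 + (1 + 2 * k) * (c * c)) * 4
    identity = solve-∀

  E-even-ab : ∀ u v c → E (2 * u) (2 * v) c ≡ 0
  E-even-ab u v c = E-mod4 (2 * u) (2 * v) c 0 (3 * (u * u) + 5 * (v * v) + β * (c * c)) (λ ()) (identity u v k c)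
    where
    identity : ∀ u v k c → 3 * (2 * u * (2 * u)) + 5 * (2 * v * (2 * v)) + 4 * (1 + 2 * k) * (c * c)
                         ≡ 0 + (3 * (u * u) + 5 * (v * v) + (1 + 2 * k) * (c * c)) * 4
    identity = solve-∀

  E-A-even-c : ∀ s v t → E (2 * (2 * s)) (1 + 2 * v) (2 * t) ≡ 0
  E-A-even-c s v t = E-mod8 a b c 5 (6 * (s * s) + 5 * T v + 2 * β * (t * t)) (λ ())
    (trans (form-squares a b c refl (odd-square v) refl) (identity s (T v) k t))
    where
    a b c : ℕ
    a = 2 * (2 * s)
    b = 1 + 2 * v
    c = 2 * t
    identity : ∀ s x k t → 3 * (2 * (2 * s) * (2 * (2 * s))) + 5 * (1 + 8 * x) + 4 * (1 + 2 * k) * (2 * t * (2 * t))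
                         ≡ 5 + (6 * (s * s) + 5 * x + 2 * (1 + 2 * k) * (t * t)) * 8
    identity = solve-∀

  double-odd-square : ∀ s → 2 * (1 + 2 * s) * (2 * (1 + 2 * s)) ≡ 4 * (1 + 8 * T s)
  double-odd-square s = trans (regroup s) (cong (4 *_) (odd-square s))
    where
    regroup : ∀ s → 2 * (1 + 2 * s) * (2 * (1 + 2 * s)) ≡ 4 * ((1 + 2 * s) * (1 + 2 * s))
    regroup = solve-∀

  E-B-odd-c : ∀ s v t → E (2 * (1 + 2 * s)) (1 + 2 * v) (1 + 2 * t) ≡ 0
  E-B-odd-c s v t = E-mod8 a b c 5 (2 + 12 * T s + 5 * T v + k + 4 * β * T t) (λ ())
    (trans (form-squares a b c (double-odd-square s) (odd-square v) (odd-square t)) (identity (T s) (T v) (T t) k))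
    where
    a b c : ℕ
    a = 2 * (1 + 2 * s)
    b = 1 + 2 * v
    c = 1 + 2 * t
    identity : ∀ x y z k → 3 * (4 * (1 + 8 * x)) + 5 * (1 + 8 * y) + 4 * (1 + 2 * k) * (1 + 8 * z)
                         ≡ 5 + (2 + 12 * x + 5 * y + k + 4 * (1 + 2 * k) * z) * 8
    identity = solve-∀

  XA : ℕ → ℕ → ℕ → ℕ
  XA s v t = 6 * (s * s) + 5 * T v + 4 * β * T t

  XB : ℕ → ℕ → ℕ → ℕ
  XB t v s = 2 * β * (t * t) + 5 * T v + 12 * T s

  family-A : ℕ → ℕ → ℕ → ℕ
  family-A s v t = δ (XA s v t + k) n

  family-B : ℕ → ℕ → ℕ → ℕ
  family-B s v t = δ (XB t v s + 1) n

  E-A : ∀ s v t → E (2 * (2 * s)) (1 + 2 * v) (1 + 2 * t) ≡ family-A s v t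
  E-A s v t = trans (cong (λ m → δ m (8 * n + 9))
      (trans (form-squares a b c refl (odd-square v) (odd-square t)) (identity s (T v) (T t) k)))
    (δ-affine 8 9 (XA s v t + k) n)
    where
    a b c : ℕ
    a = 2 * (2 * s)
    b = 1 + 2 * v
    c = 1 + 2 * t
    identity : ∀ s x y k → 3 * (2 * (2 * s) * (2 * (2 * s))) + 5 * (1 + 8 * x) + 4 * (1 + 2 * k) * (1 + 8 * y)
                         ≡ 8 * (6 * (s * s) + 5 * x + 4 * (1 + 2 * k) * y + k) + 9
    identity = solve-∀

  E-B : ∀ s v t → E (2 * (1 + 2 * s)) (1 + 2 * v) (2 * t) ≡ family-B s v t
  E-B s v t = trans (cong (λ m → δ m (8 * n + 9))
      (trans (form-squares a b c (double-odd-square s) (odd-square v) refl) (identity (T s) (T v) t k)))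
    (δ-affine 8 9 (XB t v s + 1) n)
    where
    a b c : ℕ
    a = 2 * (1 + 2 * s)
    b = 1 + 2 * v
    c = 2 * t
    identity : ∀ x y t k → 3 * (4 * (1 + 8 * x)) + 5 * (1 + 8 * y) + 4 * (1 + 2 * k) * (2 * t * (2 * t))
                         ≡ 8 * (2 * (1 + 2 * k) * (t * t) + 5 * y + 12 * x + 1) + 9
    identity = solve-∀

  -- Each variable is bounded by the value of the form, so E vanishes beyond 8n + 9.
  E-beyond : ∀ a b c → let B = suc (8 * n + 9) in B ≤ a ⊎ B ≤ b ⊎ B ≤ c → E a b c ≡ 0
  E-beyond a b c big = δ-no (λ form≡ → <⇒≱ (bounded big) (≤-reflexive form≡))
    where
    scaled-square : ∀ C x .{{_ : NonZero C}} → x ≤ C * (x * x)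
    scaled-square C x = ≤-trans (square-inflationary x) (m≤n*m (x * x) C)
    a≤ : a ≤ form a b c
    a≤ = ≤-trans (scaled-square 3 a) (≤-trans (m≤m+n _ (5 * (b * b))) (m≤m+n _ (4 * β * (c * c))))
    b≤ : b ≤ form a b c
    b≤ = ≤-trans (scaled-square 5 b) (≤-trans (m≤n+m _ (3 * (a * a))) (m≤m+n _ (4 * β * (c * c))))
    c≤ : c ≤ form a b c
    c≤ = ≤-trans (scaled-square (4 * β) c) (m≤n+m _ (3 * (a * a) + 5 * (b * b)))
    bounded : suc (8 * n + 9) ≤ a ⊎ suc (8 * n + 9) ≤ b ⊎ suc (8 * n + 9) ≤ c → 8 * n + 9 < form a b c
    bounded (inj₁ big-a)        = ≤-trans big-a a≤
    bounded (inj₂ (inj₁ big-b)) = ≤-trans big-b b≤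
    bounded (inj₂ (inj₂ big-c)) = ≤-trans big-c c≤

  solutions-split : ∀ K →
    W³ (K + K + (K + K)) (K + K + (K + K)) (K + K + (K + K)) w w w E
      ≡ W³ K (K + K) (K + K) w (λ _ → 2) (λ _ → 2) family-A
        + W³ K (K + K) (K + K) (λ _ → 2) (λ _ → 2) w family-B
  solutions-split K = begin
    ∑ L (λ a → w a * over-b a)
      ≡⟨ ∑-evens K₂ _ (λ u → trans (cong (2 *_) (a-even u)) (*-zeroʳ 2)) ⟩
    ∑ K₂ (λ u → w (2 * u) * over-b (2 * u))
      ≡⟨ ∑-parity K _ ⟩
    ∑ K (λ s → w (2 * (2 * s)) * over-b (2 * (2 * s))) + ∑ K (λ s → 2 * over-b (2 * (1 + 2 * s)))
      ≡⟨ cong₂ _+_ (∑-cong K (λ s → cong₂ _*_ (trans (w-double (2 * s)) (w-double s)) (solutions-A s)))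
                   (∑-cong K (λ s → cong (2 *_) (solutions-B s))) ⟩
    W³ K K₂ K₂ w (λ _ → 2) (λ _ → 2) family-A + W³ K K₂ K₂ (λ _ → 2) (λ _ → 2) w family-B  ∎
    where
    K₂ L : ℕ
    K₂ = K + K
    L  = K₂ + K₂
    over-c : ℕ → ℕ → ℕ
    over-c a b = ∑ L (λ c → w c * E a b c)
    over-b : ℕ → ℕ
    over-b a = ∑ L (λ b → w b * over-c a b)
    a-even : ∀ u → over-b (1 + 2 * u) ≡ 0
    a-even u = ∑-weighted-zero L w (λ b → ∑-weighted-zero L w (E-odd-a u b))
    b-odd : ∀ u → over-b (2 * u) ≡ ∑ K₂ (λ v → 2 * over-c (2 * u) (1 + 2 * v))
    b-odd u = ∑-odds K₂ _ (λ v → trans (cong (w (2 * v) *_) (∑-weighted-zero L w (E-even-ab u v))) (*-zeroʳ (w (2 * v))))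
    solutions-A : ∀ s → over-b (2 * (2 * s)) ≡ ∑ K₂ (λ v → 2 * ∑ K₂ (λ t → 2 * family-A s v t))
    solutions-A s = trans (b-odd (2 * s)) (∑-cong K₂ (λ v → cong (2 *_) (begin
      over-c (2 * (2 * s)) (1 + 2 * v)
        ≡⟨ ∑-odds K₂ _ (λ t → trans (cong (w (2 * t) *_) (E-A-even-c s v t)) (*-zeroʳ (w (2 * t)))) ⟩
      ∑ K₂ (λ t → 2 * E (2 * (2 * s)) (1 + 2 * v) (1 + 2 * t))
        ≡⟨ ∑-cong K₂ (λ t → cong (2 *_) (E-A s v t)) ⟩
      ∑ K₂ (λ t → 2 * family-A s v t)  ∎)))
    solutions-B : ∀ s → over-b (2 * (1 + 2 * s)) ≡ ∑ K₂ (λ v → 2 * ∑ K₂ (λ t → w t * family-B s v t))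
    solutions-B s = trans (b-odd (1 + 2 * s)) (∑-cong K₂ (λ v → cong (2 *_) (begin
      over-c (2 * (1 + 2 * s)) (1 + 2 * v)
        ≡⟨ ∑-evens K₂ _ (λ t → trans (cong (2 *_) (E-B-odd-c s v t)) (*-zeroʳ 2)) ⟩
      ∑ K₂ (λ t → w (2 * t) * E (2 * (1 + 2 * s)) (1 + 2 * v) (2 * t))
        ≡⟨ ∑-cong K₂ (λ t → cong₂ _*_ (w-double t) (E-B s v t)) ⟩
      ∑ K₂ (λ t → w t * family-B s v t)  ∎)))

  below : ∀ {K m} → n < K → m ≤ n → m < K
  below n<K m≤n = ≤-<-trans m≤n n<K

  below₂ : ∀ {K m} → n < K → m ≤ n → m < K + K
  below₂ {K} n<K m≤n = <-≤-trans (below n<K m≤n) (m≤m+n K K)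

  series-A : ∀ K → n < K →
    shift k (dil 6 φ ⊛ dil 5 ψ ⊛ dil (4 * β) ψ) n ≡ W³ K (K + K) (K + K) w (λ _ → 1) (λ _ → 1) family-A
  series-A K n<K = shift-W³ k n _ K (K + K) (K + K) w (λ _ → 1) (λ _ → 1) XA (λ m m≤n →
    counts-⊛⊛ (counts-dil counts-φ 6) (counts-dil counts-ψ 5) (counts-dil counts-ψ (4 * β))
      m K (K + K) (K + K) (below n<K m≤n) (below₂ n<K m≤n) (below₂ n<K m≤n))

  series-B : ∀ K → n < K →
    shift 1 (dil (2 * β) φ ⊛ dil 5 ψ ⊛ dil 12 ψ) n
      ≡ W³ (K + K) (K + K) K w (λ _ → 1) (λ _ → 1) (λ t v s → family-B s v t)
  series-B K n<K = shift-W³ 1 n _ (K + K) (K + K) K w (λ _ → 1) (λ _ → 1) XB (λ m m≤n →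
    counts-⊛⊛ (counts-dil counts-φ (2 * β)) (counts-dil counts-ψ 5) (counts-dil counts-ψ 12)
      m (K + K) (K + K) K (below₂ n<K m≤n) (below₂ n<K m≤n) (below n<K m≤n))

half-predecessor : ∀ k → (1 + 2 * k ∸ 1) / 2 ≡ k
half-predecessor k = trans (cong (_/ 2) (*-comm 2 k)) (m*n/n≡m k 2)

lemma6p4 : (b : ℕ) → Odd b → (n : ℕ) →
    N 3 5 (4 * b) (8 * n + 9)
      ≡ (4 · shift ((b ∸ 1) / 2) (dil 6 φ ⊛ dil 5 ψ ⊛ dil (4 * b) ψ)
         ⊕ 4 · shift 1 (dil (2 * b) φ ⊛ dil 5 ψ ⊛ dil 12 ψ)) n
lemma6p4 .(1 + 2 * k) (k , refl) n = begin
  N 3 5 (4 * β) M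
    ≡⟨ N-as-W³ 3 5 (4 * β) M ⟩
  W³ (suc M) (suc M) (suc M) w w w E
    ≡⟨ sym (W³-truncate (suc M) L w w w E M<L E-beyond) ⟩
  W³ L L L w w w E
    ≡⟨ solutions-split K ⟩
  W³ K K₂ K₂ w two two family-A + W³ K K₂ K₂ two two w family-B
    ≡⟨ cong (W³ K K₂ K₂ w two two family-A +_) (W³-reverse K K₂ K₂ two two w family-B) ⟩
  W³ K K₂ K₂ w two two family-A + W³ K₂ K₂ K w two two (λ t v s → family-B s v t)
    ≡⟨ cong₂ _+_ (W³-scale K K₂ K₂ w one one 2 2 family-A) (W³-scale K₂ K₂ K w one one 2 2 _) ⟩
  4 * W³ K K₂ K₂ w one one family-A + 4 * W³ K₂ K₂ K w one one (λ t v s → family-B s v t)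
    ≡⟨ sym (cong₂ (λ A B → 4 * A + 4 * B) (series-A K n<K) (series-B K n<K)) ⟩
  4 * shift k FA n + 4 * shift 1 FB n
    ≡⟨ cong (λ j → 4 * shift j FA n + 4 * shift 1 FB n) (sym (half-predecessor k)) ⟩
  4 * shift ((β ∸ 1) / 2) FA n + 4 * shift 1 FB n  ∎
  where
  open Solutions k n
  M K K₂ L : ℕ
  M  = 8 * n + 9
  K  = 2 * n + 3
  K₂ = K + K
  L  = K₂ + K₂
  one two : ℕ → ℕ
  one _ = 1
  two _ = 2
  FA FB : Series
  FA = dil 6 φ ⊛ dil 5 ψ ⊛ dil (4 * β) ψ
  FB = dil (2 * β) φ ⊛ dil 5 ψ ⊛ dil 12 ψ
  -- K = 2n + 3 exceeds n, and the cube [0, 4K)³ contains all solutions.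
  double : ∀ n → suc n + (n + 2) ≡ 2 * n + 3
  double = solve-∀
  quadruple : ∀ n → 2 * n + 3 + (2 * n + 3) + (2 * n + 3 + (2 * n + 3)) ≡ 2 + suc (8 * n + 9)
  quadruple = solve-∀
  n<K : n < K
  n<K = ≤-trans (m≤m+n (suc n) (n + 2)) (≤-reflexive (double n))
  M<L : suc M ≤ L
  M<L = subst (suc M ≤_) (sym (quadruple n)) (m≤n+m (suc M) 2)
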